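{- Let $\mathcal S=(\mathcal P,\mathcal L)$ be a finite thick generalized quadrangle of order $(s,t)$ and $G$ an automorphism group acting primitively on $\mathcal P$ with O'Nan–Scott type HS, $\mathrm{soc}(G)=T\times T$, with $\mathcal P$ identified with $T$ as in the context. Let $\ell$ be a line incident with the point $1$, let $u$ be an involution of $T$ with $u\in\bar\ell$, and let $g=(u,u)\in T\times T$. Let $H=C_T(u)$. Then: (1) for every line $\ell'$ fixed by $g$ there exist $y\in H$ and a line $m$ incident with $1$ such that $\ell'=m^{(y,1)}$; (2) $\mathcal P_1(g)=N_T(\bar\ell)\setminus H$, and $N_T(\bar\ell)=H\bar\ell$.
   Context: A finite generalized quadrangle of order $(s,t)$ is a point-line incidence structure whose incidence graph is bipartite of diameter $4$ and girth $8$, with $s+1$ points per line and $t+1$ lines per point; thick means $s,t\ge 2$. O'Nan–Scott type HS: $\mathrm{soc}(G)=T\times T$, $T$ nonabelian simple, both factors minimal normal and regular, point stabilizer in the socle the diagonal $\{(x,x):x\in T\}$. The point set is identified with $T$ so that the point with socle-stabilizer the diagonal is $1$ and $(g_1,g_2)\in T\times T$ maps the point $y$ to $g_2^{ -1}yg_1$. For a line $m$, $\bar m\subseteq T$ is the set of points incident with $m$, and $N_T(\bar m)=\{x\in T:x^{ -1}\bar m x=\bar m\}$. For an automorphism $g$ of $\mathcal S$, $\mathcal P_1(g)$ is the set of points $x$ with $x^g\ne x$ and $x^g$ collinear with $x$. -}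

module Defs where

open import Level using (0ℓ)
open import Data.Nat using (ℕ; zero; suc; _≤_; _<_; _%_)
open import Data.Fin using (Fin; toℕ)
open import Data.Bool using (Bool; true; false)
open import Data.Product using (Σ; _×_; _,_; ∃; ∃-syntax)
open import Data.Sum using (_⊎_; inj₁; inj₂)
open import Data.Empty using (⊥)
open import Relation.Nullary using (¬_)
open import Relation.Unary using (Pred; Decidable; _⊆_)
open import Relation.Binary using (IsEquivalence)
open import Relation.Binary.PropositionalEquality using (_≡_; _≢_)
open import Function.Bundles using (_↔_)
open import Function.Definitions using (Injective)
open import Algebra.Structures using (IsGroup)

record FinGroup : Set₁ where
  infixl 7 _∙_
  field
    Carrier : Set
    _∙_     : Carrier → Carrier → Carrier
    ε       : Carrier
    _⁻¹     : Carrier → Carrier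
    isGroup : IsGroup _≡_ _∙_ ε _⁻¹
    size    : ℕ
    enum    : Carrier ↔ Fin size

module _ (G : FinGroup) where
  open FinGroup G

  IsNormal : Pred Carrier 0ℓ → Set
  IsNormal N =
    N ε × (∀ x y → N x → N y → N (x ∙ y)) × (∀ x → N x → N (x ⁻¹))
      × (∀ g x → N x → N ((g ⁻¹) ∙ x ∙ g))

  IsTrivial : Pred Carrier 0ℓ → Set
  IsTrivial N = ∀ x → N x → x ≡ ε

  IsMinimalNormal : Pred Carrier 0ℓ → Set₁
  IsMinimalNormal N =
    IsNormal N × (∃[ x ] (N x × x ≢ ε))
      × (∀ (M : Pred Carrier 0ℓ) → Decidable M → IsNormal M → M ⊆ N
           → IsTrivial M ⊎ N ⊆ M)

  IsNonabelianSimple : Set₁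
  IsNonabelianSimple =
    (∃[ x ] ∃[ y ] (x ∙ y ≢ y ∙ x))
      × (∀ (M : Pred Carrier 0ℓ) → Decidable M → IsNormal M
           → IsTrivial M ⊎ (∀ x → M x))

data Walk {V : Set} (adj : V → V → Set) : V → V → ℕ → Set where
  here : ∀ {v} → Walk adj v v 0
  step : ∀ {u v w n} → adj u v → Walk adj v w n → Walk adj u w (suc n)

HasDiameter : {V : Set} → (V → V → Set) → ℕ → Set
HasDiameter {V} adj d =
  (∀ u v → ∃[ n ] (n ≤ d × Walk adj u v n))
    × (∃[ u ] ∃[ v ] (∀ n → Walk adj u v n → d ≤ n))

HasCycle : {V : Set} → (V → V → Set) → ℕ → Set
HasCycle adj zero = ⊥
HasCycle {V} adj (suc n) =
  Σ (Fin (suc n) → V) λ f →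
    Injective _≡_ _≡_ f
      × (∀ i j → toℕ j ≡ suc (toℕ i) % suc n → adj (f i) (f j))

HasGirth : {V : Set} → (V → V → Set) → ℕ → Set
HasGirth adj g =
  HasCycle adj g × (∀ k → 3 ≤ k → k < g → ¬ HasCycle adj k)

IncAdj : {P Line : Set} → (P → Line → Bool) → P ⊎ Line → P ⊎ Line → Set
IncAdj _I_ (inj₁ x) (inj₂ m) = (x I m) ≡ true
IncAdj _I_ (inj₂ m) (inj₁ x) = (x I m) ≡ true
IncAdj _I_ (inj₁ _) (inj₁ _) = ⊥
IncAdj _I_ (inj₂ _) (inj₂ _) = ⊥

record GQ (P : Set) : Set₁ where
  field
    Line      : Set
    nLines    : ℕ
    lineEnum  : Line ↔ Fin nLines
    _I_       : P → Line → Bool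
    s t       : ℕ
    thick     : 2 ≤ s × 2 ≤ t
    ptsOnLine : ∀ m → Fin (suc s) ↔ Σ P (λ x → (x I m) ≡ true)
    linesOnPt : ∀ x → Fin (suc t) ↔ Σ Line (λ m → (x I m) ≡ true)

    diam4     : HasDiameter (IncAdj _I_) 4
    girth8    : HasGirth (IncAdj _I_) 8

  Collinear : P → P → Set
  Collinear x y = ∃[ m ] ((x I m) ≡ true × (y I m) ≡ true)

-- A finite group G acting (on the right, x ↦ x^g) faithfully as
-- automorphisms of S, i.e. G ≤ Aut(S)

record AutGroup {P : Set} (S : GQ P) (G : FinGroup) : Set where
  open GQ S
  open FinGroup G
  field
    pt      : Carrier → P → P
    ln      : Carrier → Line → Line
    pt-ε    : ∀ x → pt ε x ≡ x
    pt-∙    : ∀ g h x → pt (g ∙ h) x ≡ pt h (pt g x)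
    ln-ε    : ∀ m → ln ε m ≡ m
    ln-∙    : ∀ g h m → ln (g ∙ h) m ≡ ln h (ln g m)
    inc     : ∀ g x m → (x I m) ≡ (pt g x I ln g m)
    faithful : ∀ g → (∀ x → pt g x ≡ x) → (∀ m → ln g m ≡ m) → g ≡ ε

  IsPrimitive : Set₁
  IsPrimitive =
    (∀ x y → ∃[ g ] (pt g x ≡ y))
      × (∀ (R : P → P → Set) → (∀ x y → R x y ⊎ ¬ R x y) → IsEquivalence R
           → (∀ g x y → R x y → R (pt g x) (pt g y))
           → (∀ x y → R x y → x ≡ y) ⊎ (∀ x y → R x y))

-- O'Nan–Scott type HS with soc(G) = T × T, points identified with T:
-- ι embeds T × T into G, (g₁ , g₂) maps the point y to g₂⁻¹ y g₁,
-- T × 1 and 1 × T are minimal normal in G, and every minimal normal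
-- subgroup of G lies in T × T (so soc(G) = T × T).

record HSType (T : FinGroup) (S : GQ (FinGroup.Carrier T)) (G : FinGroup)
              (A : AutGroup S G) : Set₁ where
  private
    module T = FinGroup T
    module G = FinGroup G
  open AutGroup A
  field
    ι       : T.Carrier × T.Carrier → G.Carrier
    ι-hom   : ∀ a b c d → ι (a T.∙ c , b T.∙ d) ≡ ι (a , b) G.∙ ι (c , d)
    ι-inj   : Injective _≡_ _≡_ ι
    ι-act   : ∀ g₁ g₂ y → pt (ι (g₁ , g₂)) y ≡ (g₂ T.⁻¹) T.∙ y T.∙ g₁
    T-simple : IsNonabelianSimple T
    G-primitive : IsPrimitive
    left-minNormal  : IsMinimalNormal G (λ g → ∃[ a ] (ι (a , T.ε) ≡ g))
    right-minNormal : IsMinimalNormal G (λ g → ∃[ b ] (ι (T.ε , b) ≡ g))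
    soc⊆ : ∀ (M : Pred G.Carrier 0ℓ) → Decidable M → IsMinimalNormal G M
             → ∀ g → M g → ∃[ p ] (ι p ≡ g)

-- In a generalized quadrangle two points lie on at most one line (no 4-cycles)
-- and a point off a line is collinear with exactly one of its points (no
-- 6-cycles, diameter 4). So an automorphism stabilises ℓ once it maps 1 and u
-- into ℓ̄; consequently ℓ̄ is closed under y ↦ y u and y ↦ y⁻¹, x normalises ℓ̄
-- exactly when conjugation by x stabilises ℓ, and C_T(u) and ℓ̄ both normalise
-- ℓ̄. An automorphism fixing a point and a line fixes the projection of the
-- point onto the line; for g = (u , u), which fixes 1, such points lie in
-- C_T(u). Applied to a g-fixed line this gives (1); applied to x ℓ̄, which g
-- stabilises when x ∈ N_T(ℓ̄), it gives x ∈ C_T(u) ℓ̄. Finally x⁻¹ u x is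
-- always collinear with 1, and it is collinear with u exactly when x^g is
-- collinear with x, so x ∈ P₁(g) forces x⁻¹ u x ∈ ℓ̄.
module Submission where

open import Level using (0ℓ)
open import Data.Bool using (true) renaming (_≟_ to _≟ᵇ_)
open import Data.Empty using (⊥-elim)
open import Data.Fin using (toℕ; zero; suc)
open import Data.Fin.Properties using (toℕ-injective; toℕ-fromℕ<; inj⇒≟)
open import Data.Nat using (ℕ; suc; _≤_; s≤s)
open import Data.Nat.DivMod using (_mod_)
open import Data.Nat.Properties using (n≤1+n; m≤m+n)
open import Data.Product using (_×_; _,_; ∃-syntax; proj₁; proj₂)
open import Data.Sum using (inj₁; inj₂)
open import Data.Sum.Properties using (inj₁-injective; inj₂-injective)
open import Data.Vec using (Vec; []; _∷_; lookup)
open import Data.Vec.Relation.Unary.All using ([]; _∷_)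
open import Data.Vec.Relation.Unary.AllPairs using ([]; _∷_)
open import Data.Vec.Relation.Unary.Unique.Propositional using (Unique)
open import Data.Vec.Relation.Unary.Unique.Propositional.Properties using (lookup-injective)
open import Function using (_∘_)
open import Function.Bundles using (_⇔_; mk⇔; Equivalence)
open import Function.Properties.Inverse using (↔⇒↣)
open import Function.Construct.Composition using (_⇔-∘_)
open import Function.Construct.Identity using (⇔-id)
open import Function.Construct.Symmetry using (⇔-sym)
open import Data.Product.Function.NonDependent.Propositional using (_×-⇔_)
open import Relation.Nullary using (¬_; yes; no)
open import Relation.Binary.Definitions using (DecidableEquality)
open import Relation.Binary.PropositionalEquality
open import Algebra.Bundles using (Group)
open import Algebra.Structures using (IsGroup)
open import Defs

closedWalk⇒HasCycle : {V : Set} {adj : V → V → Set} {n : ℕ} (vs : Vec V (suc n)) → Unique vs →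
  (∀ i → adj (lookup vs i) (lookup vs (suc (toℕ i) mod suc n))) → HasCycle adj (suc n)
closedWalk⇒HasCycle {adj = adj} vs distinct link =
  lookup vs , lookup-injective distinct _ _ , λ i j j≡1+i →
    subst (λ k → adj (lookup vs i) (lookup vs k))
          (toℕ-injective (trans (toℕ-fromℕ< _) (sym j≡1+i))) (link i)

FinGroup⇒Group : FinGroup → Group 0ℓ 0ℓ
FinGroup⇒Group T = record { FinGroup T; _≈_ = _≡_ }

FinGroup-≟ : (T : FinGroup) → DecidableEquality (FinGroup.Carrier T)
FinGroup-≟ T = inj⇒≟ (↔⇒↣ (FinGroup.enum T))

module Quadrangle {P : Set} (S : GQ P) (_≟_ : DecidableEquality P) where
  open GQ S

  infix 4 _on_
  _on_ : P → Line → Set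
  x on m = (x I m) ≡ true

  private
    adj = IncAdj _I_

    _≟ₗ_ : DecidableEquality Line
    _≟ₗ_ = inj⇒≟ (↔⇒↣ lineEnum)

  line-unique : ∀ {p q m m′} → p ≢ q → p on m → q on m → p on m′ → q on m′ → m ≡ m′
  line-unique {m = m} {m′} p≢q pm qm pm′ qm′ with m ≟ₗ m′
  ... | yes m≡m′ = m≡m′
  ... | no m≢m′ = ⊥-elim (proj₂ girth8 4 (n≤1+n 3) (m≤m+n 5 3) square)
    where
    square : HasCycle adj 4
    square = closedWalk⇒HasCycle {adj = adj} (inj₁ _ ∷ inj₂ m ∷ inj₁ _ ∷ inj₂ m′ ∷ [])
      ( ((λ ()) ∷ p≢q ∘ inj₁-injective ∷ (λ ()) ∷ [])
      ∷ ((λ ()) ∷ m≢m′ ∘ inj₂-injective ∷ [])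
      ∷ ((λ ()) ∷ []) ∷ [] ∷ [])
      λ { zero → pm ; (suc zero) → qm ; (suc (suc zero)) → qm′ ; (suc (suc (suc zero))) → pm′ }

  projection-unique : ∀ {z m p q} → ¬ z on m → p on m → q on m →
                      Collinear z p → Collinear z q → p ≡ q
  projection-unique {z} {m} {p} {q} z∉m pm qm (n , zn , pn) (n′ , zn′ , qn′) with p ≟ q
  ... | yes p≡q = p≡q
  ... | no p≢q = ⊥-elim (proj₂ girth8 6 (m≤m+n 3 3) (m≤m+n 7 1) hexagon)
    where
    off : ∀ {x} → x on m → z ≢ x
    off xm refl = z∉m xm
    n≢m : ∀ {k} → z on k → k ≢ m
    n≢m zk refl = z∉m zk
    n≢n′ : n ≢ n′
    n≢n′ refl = n≢m zn (line-unique p≢q pn qn′ pm qm)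
    hexagon : HasCycle adj 6
    hexagon = closedWalk⇒HasCycle {adj = adj}
      (inj₁ z ∷ inj₂ n ∷ inj₁ p ∷ inj₂ m ∷ inj₁ q ∷ inj₂ n′ ∷ [])
      ( ((λ ()) ∷ off pm ∘ inj₁-injective ∷ (λ ()) ∷ off qm ∘ inj₁-injective ∷ (λ ()) ∷ [])
      ∷ ((λ ()) ∷ n≢m zn ∘ inj₂-injective ∷ (λ ()) ∷ n≢n′ ∘ inj₂-injective ∷ [])
      ∷ ((λ ()) ∷ p≢q ∘ inj₁-injective ∷ (λ ()) ∷ [])
      ∷ ((λ ()) ∷ (n≢m zn′ ∘ sym) ∘ inj₂-injective ∷ [])
      ∷ ((λ ()) ∷ []) ∷ [] ∷ [])
      λ { zero → zn ; (suc zero) → pn ; (suc (suc zero)) → pm ; (suc (suc (suc zero))) → qm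
        ; (suc (suc (suc (suc zero)))) → qn′ ; (suc (suc (suc (suc (suc zero))))) → zn′ }

  private
    -- Walks from a point to a line have odd length, so here length 1 or 3.
    shortWalk⇒projection : ∀ {z m k} → k ≤ 4 → Walk adj (inj₁ z) (inj₂ m) k → ¬ z on m →
                           ∃[ p ] (p on m × Collinear z p)
    shortWalk⇒projection _ (step {v = inj₁ _} () _) _
    shortWalk⇒projection _ (step {v = inj₂ _} zm here) z∉m = ⊥-elim (z∉m zm)
    shortWalk⇒projection _ (step {v = inj₂ _} _ (step {v = inj₂ _} () _)) _
    shortWalk⇒projection _ (step {v = inj₂ _} _ (step {v = inj₁ _} _ (step {v = inj₁ _} () _))) _
    shortWalk⇒projection _ (step {v = inj₂ n} zn (step {v = inj₁ p} pn (step {v = inj₂ _} pm here))) _ =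
      p , pm , n , zn , pn
    shortWalk⇒projection _
      (step {v = inj₂ _} _ (step {v = inj₁ _} _ (step {v = inj₂ _} _ (step {v = inj₂ _} () _)))) _
    shortWalk⇒projection (s≤s (s≤s (s≤s (s≤s ()))))
      (step _ (step _ (step _ (step {v = inj₁ _} _ (step _ _))))) _

  projection : ∀ {z m} → ¬ z on m → ∃[ p ] (p on m × Collinear z p)
  projection {z} {m} with proj₁ diam4 (inj₁ z) (inj₂ m)
  ... | _ , k≤4 , walk = shortWalk⇒projection k≤4 walk

  collinear₂⇒on : ∀ {w m p q} → p ≢ q → p on m → q on m → Collinear w p → Collinear w q → w on m
  collinear₂⇒on {w} {m} p≢q pm qm wp wq with (w I m) ≟ᵇ true
  ... | yes wm = wm
  ... | no w∉m = ⊥-elim (p≢q (projection-unique w∉m pm qm wp wq))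

module Automorphisms {P : Set} {S : GQ P} {G : FinGroup} (A : AutGroup S G)
                     (_≟_ : DecidableEquality P) where
  open GQ S
  open AutGroup A
  open Quadrangle S _≟_
  private
    module G = FinGroup G
    open IsGroup G.isGroup using (inverseˡ; inverseʳ)

  pt-cancel : ∀ {k h} → k G.∙ h ≡ G.ε → ∀ y → pt h (pt k y) ≡ y
  pt-cancel kh≡ε y = trans (sym (pt-∙ _ _ y)) (trans (cong (λ c → pt c y) kh≡ε) (pt-ε y))

  pt-injective : ∀ k {p q} → pt k p ≡ pt k q → p ≡ q
  pt-injective k {p} {q} e =
    trans (sym (pt-cancel (inverseʳ k) p)) (trans (cong (pt (k G.⁻¹)) e) (pt-cancel (inverseʳ k) q))

  on-image : ∀ k {z m} → z on m → pt k z on ln k m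
  on-image k {z} {m} zm = trans (sym (inc k z m)) zm

  on-image⁻¹ : ∀ k {w m} → w on ln k m → ∃[ z ] (z on m × w ≡ pt k z)
  on-image⁻¹ k {w} {m} wkm = pt (k G.⁻¹) w , z-on , sym (pt-cancel (inverseˡ k) w)
    where
    z-on : pt (k G.⁻¹) w on m
    z-on = trans (inc k _ m) (subst (_on ln k m) (sym (pt-cancel (inverseˡ k) w)) wkm)

  collinear-image : ∀ k {p q} → Collinear p q → Collinear (pt k p) (pt k q)
  collinear-image k (m , pm , qm) = ln k m , on-image k pm , on-image k qm

  on-fixedLine : ∀ k {z m} → ln k m ≡ m → z on m → pt k z on m
  on-fixedLine k km≡m zm = subst (_ on_) km≡m (on-image k zm)

  fixes-line : ∀ k {p q m} → p ≢ q → p on m → q on m → pt k p on m → pt k q on m → ln k m ≡ m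
  fixes-line k p≢q pm qm kpm kqm =
    line-unique (p≢q ∘ pt-injective k) (on-image k pm) (on-image k qm) kpm kqm

  fixedLine⇒fixedPoint : ∀ k {z n} → pt k z ≡ z → ln k n ≡ n → ∃[ p ] (p on n × pt k p ≡ p)
  fixedLine⇒fixedPoint k {z} {n} kz≡z kn≡n with (z I n) ≟ᵇ true
  ... | yes zn = z , zn , kz≡z
  ... | no z∉n with projection z∉n
  ... | p , pn , zp = p , pn , sym (projection-unique z∉n pn (on-fixedLine k kn≡n pn) zp kz-kp)
    where
    kz-kp : Collinear z (pt k p)
    kz-kp = subst (λ y → Collinear y (pt k p)) kz≡z (collinear-image k zp)

module Conjugation (T : FinGroup) where
  open FinGroup T
  open IsGroup isGroup using (assoc; identityʳ; inverseˡ)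
  open import Algebra.Properties.Group (FinGroup⇒Group T) using (\\-leftDividesˡ; \\-leftDividesʳ)
  open ≡-Reasoning

  conj-ε : ∀ x → x ⁻¹ ∙ ε ∙ x ≡ ε
  conj-ε x = trans (cong (_∙ x) (identityʳ (x ⁻¹))) (inverseˡ x)

  comm⇒conj-fixed : ∀ {x y} → y ∙ x ≡ x ∙ y → x ⁻¹ ∙ y ∙ x ≡ y
  comm⇒conj-fixed {x} {y} yx≡xy = begin
    x ⁻¹ ∙ y ∙ x   ≡⟨ assoc _ _ _ ⟩
    x ⁻¹ ∙ (y ∙ x) ≡⟨ cong (x ⁻¹ ∙_) yx≡xy ⟩
    x ⁻¹ ∙ (x ∙ y) ≡⟨ \\-leftDividesʳ x y ⟩
    y              ∎

  conj-fixed⇒comm : ∀ {x y} → x ⁻¹ ∙ y ∙ x ≡ y → y ∙ x ≡ x ∙ y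
  conj-fixed⇒comm {x} {y} fixed = begin
    y ∙ x                ≡⟨ \\-leftDividesˡ x (y ∙ x) ⟨
    x ∙ (x ⁻¹ ∙ (y ∙ x)) ≡⟨ cong (x ∙_) (assoc _ _ _) ⟨
    x ∙ (x ⁻¹ ∙ y ∙ x)   ≡⟨ cong (x ∙_) fixed ⟩
    x ∙ y                ∎

  conj-cancel : ∀ a b c → a ⁻¹ ∙ b ∙ (b ⁻¹ ∙ a ∙ c) ≡ c
  conj-cancel a b c = begin
    a ⁻¹ ∙ b ∙ (b ⁻¹ ∙ a ∙ c)     ≡⟨ assoc _ _ _ ⟩
    a ⁻¹ ∙ (b ∙ (b ⁻¹ ∙ a ∙ c))   ≡⟨ cong (λ v → a ⁻¹ ∙ (b ∙ v)) (assoc _ _ _) ⟩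
    a ⁻¹ ∙ (b ∙ (b ⁻¹ ∙ (a ∙ c))) ≡⟨ cong (a ⁻¹ ∙_) (\\-leftDividesˡ b (a ∙ c)) ⟩
    a ⁻¹ ∙ (a ∙ c)                ≡⟨ \\-leftDividesʳ a c ⟩
    c                             ∎

module HSAction (T : FinGroup) (S : GQ (FinGroup.Carrier T)) (G : FinGroup)
                (A : AutGroup S G) (hs : HSType T S G A) where
  open FinGroup T
  open IsGroup isGroup using (assoc; identityˡ; identityʳ; inverseˡ; inverseʳ)
  open import Algebra.Properties.Group (FinGroup⇒Group T)
    using ( ε⁻¹≈ε; ⁻¹-involutive; inverseʳ-unique; identityʳ-unique; x≈z//y
          ; \\-leftDividesˡ; \\-leftDividesʳ)
  open GQ S
  open AutGroup A
  open HSType hs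
  open Conjugation T

  private
    _≟_ : DecidableEquality Carrier
    _≟_ = FinGroup-≟ T
    module G = FinGroup G

  open Quadrangle S _≟_
  open Automorphisms A _≟_
  import Algebra.Properties.Group (FinGroup⇒Group G) as Gᴾ
  open ≡-Reasoning

  rightMul leftMul conj : Carrier → G.Carrier
  rightMul a = ι (a , ε)
  leftMul b = ι (ε , b ⁻¹)
  conj x = ι (x , x)

  pt-rightMul : ∀ a y → pt (rightMul a) y ≡ y ∙ a
  pt-rightMul a y = trans (ι-act a ε y) (cong (_∙ a) (trans (cong (_∙ y) ε⁻¹≈ε) (identityˡ y)))

  pt-leftMul : ∀ b y → pt (leftMul b) y ≡ b ∙ y
  pt-leftMul b y = trans (ι-act ε (b ⁻¹) y) (trans (identityʳ _) (cong (_∙ y) (⁻¹-involutive b)))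

  pt-conj : ∀ x y → pt (conj x) y ≡ x ⁻¹ ∙ y ∙ x
  pt-conj x = ι-act x x

  ι-ε : ι (ε , ε) ≡ G.ε
  ι-ε = Gᴾ.identityʳ-unique (ι (ε , ε)) (ι (ε , ε)) (begin
    ι (ε , ε) G.∙ ι (ε , ε) ≡⟨ ι-hom ε ε ε ε ⟨
    ι (ε ∙ ε , ε ∙ ε)       ≡⟨ cong ι (cong₂ _,_ (identityˡ ε) (identityˡ ε)) ⟩
    ι (ε , ε)               ∎)

  ln-ι-∙ : ∀ a b c d m → ln (ι (a ∙ c , b ∙ d)) m ≡ ln (ι (c , d)) (ln (ι (a , b)) m)
  ln-ι-∙ a b c d m = trans (cong (λ k → ln k m) (ι-hom a b c d)) (ln-∙ _ _ m)

  rightMul-inverse : ∀ a m → ln (rightMul a) (ln (rightMul (a ⁻¹)) m) ≡ m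
  rightMul-inverse a m = begin
    ln (rightMul a) (ln (rightMul (a ⁻¹)) m) ≡⟨ ln-ι-∙ (a ⁻¹) ε a ε m ⟨
    ln (ι (a ⁻¹ ∙ a , ε ∙ ε)) m              ≡⟨ cong (λ p → ln (ι p) m) a⁻¹a,εε≡ε,ε ⟩
    ln (ι (ε , ε)) m                         ≡⟨ cong (λ k → ln k m) ι-ε ⟩
    ln G.ε m                                 ≡⟨ ln-ε m ⟩
    m                                        ∎
    where
    a⁻¹a,εε≡ε,ε : (a ⁻¹ ∙ a , ε ∙ ε) ≡ (ε , ε)
    a⁻¹a,εε≡ε,ε = cong₂ _,_ (inverseˡ a) (identityˡ ε)

  collinear-leftMul : ∀ c {p q} → Collinear p q → Collinear (c ∙ p) (c ∙ q)
  collinear-leftMul c col =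
    subst₂ Collinear (pt-leftMul c _) (pt-leftMul c _) (collinear-image (leftMul c) col)

  collinear-conj : ∀ x {p q} → Collinear p q → Collinear (x ⁻¹ ∙ p ∙ x) (x ⁻¹ ∙ q ∙ x)
  collinear-conj x col =
    subst₂ Collinear (pt-conj x _) (pt-conj x _) (collinear-image (conj x) col)

  module Involution (ℓ : Line) (εℓ : ε on ℓ) (u : Carrier) (u≢ε : u ≢ ε) (uu : u ∙ u ≡ ε)
                    (uℓ : u on ℓ) where
    g : G.Carrier
    g = conj u

    H : Carrier → Set
    H x = x ∙ u ≡ u ∙ x

    Nℓ : Carrier → Set
    Nℓ x = ∀ z → (∃[ a ] (a on ℓ × z ≡ x ⁻¹ ∙ a ∙ x)) ⇔ z on ℓ

    Normalises : Carrier → Set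
    Normalises x = ln (conj x) ℓ ≡ ℓ

    P₁ : Carrier → Set
    P₁ x = (pt g x ≢ x) × Collinear x (pt g x)

    ε≢u : ε ≢ u
    ε≢u = u≢ε ∘ sym

    u⁻¹≡u : u ⁻¹ ≡ u
    u⁻¹≡u = sym (inverseʳ-unique u u uu)

    g-fixes-ε : pt g ε ≡ ε
    g-fixes-ε = trans (pt-conj u ε) (conj-ε u)

    g-fixed⇒H : ∀ {x} → pt g x ≡ x → H x
    g-fixed⇒H gx≡x = conj-fixed⇒comm (trans (sym (pt-conj u _)) gx≡x)

    H⇒g-fixed : ∀ {x} → H x → pt g x ≡ x
    H⇒g-fixed hx = trans (pt-conj u _) (comm⇒conj-fixed hx)

    stabilises-ℓ : ∀ k → pt k ε on ℓ → pt k u on ℓ → ln k ℓ ≡ ℓ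
    stabilises-ℓ k = fixes-line k ε≢u εℓ uℓ

    ∙u-on-ℓ : ∀ {a} → a on ℓ → a ∙ u on ℓ
    ∙u-on-ℓ {a} aℓ = subst (_on ℓ) (pt-rightMul u a) (on-fixedLine (rightMul u) ℓu≡ℓ aℓ)
      where
      ℓu≡ℓ : ln (rightMul u) ℓ ≡ ℓ
      ℓu≡ℓ = stabilises-ℓ (rightMul u)
               (subst (_on ℓ) (sym (trans (pt-rightMul u ε) (identityˡ u))) uℓ)
               (subst (_on ℓ) (sym (trans (pt-rightMul u u) uu)) εℓ)

    ⁻¹-on-ℓ : ∀ {a} → a on ℓ → a ⁻¹ on ℓ
    ⁻¹-on-ℓ {a} aℓ =
      subst (_on ℓ) (trans (pt-leftMul (a ⁻¹) ε) (identityʳ _)) (on-fixedLine k kℓ≡ℓ εℓ)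
      where
      k = leftMul (a ⁻¹)
      kℓ≡ℓ : ln k ℓ ≡ ℓ
      kℓ≡ℓ = line-unique ε≢u
               (subst (_on ln k ℓ) (trans (pt-leftMul (a ⁻¹) a) (inverseˡ a)) (on-image k aℓ))
               (subst (_on ln k ℓ) (trans (pt-leftMul (a ⁻¹) (a ∙ u)) (\\-leftDividesʳ a u))
                      (on-image k (∙u-on-ℓ aℓ)))
               εℓ uℓ

    Nℓ⇔Normalises : ∀ x → Nℓ x ⇔ Normalises x
    Nℓ⇔Normalises x = mk⇔ to from
      where
      to : Nℓ x → Normalises x
      to N = stabilises-ℓ (conj x)
               (subst (_on ℓ) (sym (pt-conj x ε)) (Equivalence.to (N _) (ε , εℓ , refl)))
               (subst (_on ℓ) (sym (pt-conj x u)) (Equivalence.to (N _) (u , uℓ , refl)))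
      from : Normalises x → Nℓ x
      from ℓx≡ℓ z = mk⇔
        (λ { (a , aℓ , z≡) →
               subst (_on ℓ) (trans (pt-conj x a) (sym z≡)) (on-fixedLine (conj x) ℓx≡ℓ aℓ) })
        (λ zℓ → let a , aℓ , z≡ = on-image⁻¹ (conj x) (subst (z on_) (sym ℓx≡ℓ) zℓ)
                in a , aℓ , trans z≡ (pt-conj x a))

    H-normalises : ∀ {h} → H h → Normalises h
    H-normalises {h} hu≡uh = stabilises-ℓ (conj h)
      (subst (_on ℓ) (sym (trans (pt-conj h ε) (conj-ε h))) εℓ)
      (subst (_on ℓ) (sym (trans (pt-conj h u) (comm⇒conj-fixed (sym hu≡uh)))) uℓ)

    on-ℓ-normalises : ∀ {a} → a on ℓ → Normalises a
    on-ℓ-normalises {a} aℓ with a ≟ ε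
    ... | yes refl = trans (cong (λ k → ln k ℓ) ι-ε) (ln-ε ℓ)
    ... | no a≢ε = fixes-line (conj a) (a≢ε ∘ sym) εℓ aℓ
      (subst (_on ℓ) (sym (trans (pt-conj a ε) (conj-ε a))) εℓ)
      (subst (_on ℓ) (sym (trans (pt-conj a a) (comm⇒conj-fixed refl))) aℓ)

    normalises-∙ : ∀ {x y} → Normalises x → Normalises y → Normalises (x ∙ y)
    normalises-∙ {x} {y} ℓx≡ℓ ℓy≡ℓ =
      trans (ln-ι-∙ x x y y ℓ) (trans (cong (ln (conj y)) ℓx≡ℓ) ℓy≡ℓ)

    g-fixedLine⇒rightMul : (ℓ′ : Line) → ln g ℓ′ ≡ ℓ′ →
                           ∃[ y ] ∃[ m ] (H y × ε on m × ℓ′ ≡ ln (rightMul y) m)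
    g-fixedLine⇒rightMul ℓ′ gℓ′≡ℓ′ with fixedLine⇒fixedPoint g g-fixes-ε gℓ′≡ℓ′
    ... | y , yℓ′ , gy≡y =
      y , ln (rightMul (y ⁻¹)) ℓ′ , g-fixed⇒H gy≡y ,
      subst (_on ln (rightMul (y ⁻¹)) ℓ′) (trans (pt-rightMul (y ⁻¹) y) (inverseʳ y))
            (on-image (rightMul (y ⁻¹)) yℓ′) ,
      sym (rightMul-inverse y ℓ′)

    P₁⇔Normalises∖H : ∀ x → P₁ x ⇔ (Normalises x × ¬ H x)
    P₁⇔Normalises∖H x = mk⇔ to from
      where
      w = x ⁻¹ ∙ u ∙ x
      to : P₁ x → Normalises x × ¬ H x
      to (moved , x∼gx) =
        stabilises-ℓ (conj x) (subst (_on ℓ) (sym (trans (pt-conj x ε) (conj-ε x))) εℓ)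
                              (subst (_on ℓ) (sym (pt-conj x u)) wℓ) ,
        moved ∘ H⇒g-fixed
        where
        w∼u : Collinear w u
        w∼u = subst (Collinear w) (trans (cong (x ⁻¹ ∙ u ∙_) (pt-conj u x)) (conj-cancel x u u))
                    (collinear-leftMul (x ⁻¹ ∙ u) x∼gx)
        w∼ε : Collinear w ε
        w∼ε = subst (Collinear w) (conj-ε x) (collinear-conj x (ℓ , uℓ , εℓ))
        wℓ : w on ℓ
        wℓ = collinear₂⇒on ε≢u εℓ uℓ w∼ε w∼u
      from : Normalises x × ¬ H x → P₁ x
      from (ℓx≡ℓ , ¬hx) =
        ¬hx ∘ g-fixed⇒H ,
        subst₂ Collinear (conj-cancel u x x) (sym (pt-conj u x))
               (collinear-leftMul (u ⁻¹ ∙ x) (ℓ , wℓ , uℓ))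
        where
        wℓ : w on ℓ
        wℓ = subst (_on ℓ) (pt-conj x u) (on-fixedLine (conj x) ℓx≡ℓ uℓ)

    g-stabilises-translate : ∀ {x} → Normalises x → ln g (ln (leftMul x) ℓ) ≡ ln (leftMul x) ℓ
    g-stabilises-translate {x} ℓx≡ℓ =
      fixes-line g (u≢ε ∘ identityʳ-unique x u ∘ sym)
        (on-xℓ (subst (_on ℓ) (sym (inverseˡ x)) εℓ))
        (on-xℓ (subst (_on ℓ) (sym (\\-leftDividesʳ x u)) uℓ))
        (on-xℓ (subst (_on ℓ) (sym x⁻¹∙gx) (∙u-on-ℓ wℓ)))
        (on-xℓ (subst (_on ℓ) (sym x⁻¹∙gxu) wℓ))
      where
      on-xℓ : ∀ {y} → x ⁻¹ ∙ y on ℓ → y on ln (leftMul x) ℓ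
      on-xℓ {y} h =
        subst (_on _) (trans (pt-leftMul x _) (\\-leftDividesˡ x y)) (on-image (leftMul x) h)

      wℓ : x ⁻¹ ∙ u ∙ x on ℓ
      wℓ = subst (_on ℓ) (pt-conj x u) (on-fixedLine (conj x) ℓx≡ℓ uℓ)

      x⁻¹∙gx : x ⁻¹ ∙ pt g x ≡ x ⁻¹ ∙ u ∙ x ∙ u
      x⁻¹∙gx = begin
        x ⁻¹ ∙ pt g x           ≡⟨ cong (x ⁻¹ ∙_) (pt-conj u x) ⟩
        x ⁻¹ ∙ (u ⁻¹ ∙ x ∙ u)   ≡⟨ assoc _ _ _ ⟨
        x ⁻¹ ∙ (u ⁻¹ ∙ x) ∙ u   ≡⟨ cong (_∙ u) (assoc _ _ _) ⟨
        x ⁻¹ ∙ u ⁻¹ ∙ x ∙ u     ≡⟨ cong (λ v → x ⁻¹ ∙ v ∙ x ∙ u) u⁻¹≡u ⟩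
        x ⁻¹ ∙ u ∙ x ∙ u        ∎

      x⁻¹∙gxu : x ⁻¹ ∙ pt g (x ∙ u) ≡ x ⁻¹ ∙ u ∙ x
      x⁻¹∙gxu = begin
        x ⁻¹ ∙ pt g (x ∙ u)          ≡⟨ cong (x ⁻¹ ∙_) (pt-conj u (x ∙ u)) ⟩
        x ⁻¹ ∙ (u ⁻¹ ∙ (x ∙ u) ∙ u)  ≡⟨ cong (x ⁻¹ ∙_) (assoc _ _ _) ⟩
        x ⁻¹ ∙ (u ⁻¹ ∙ (x ∙ u ∙ u))  ≡⟨ cong (λ v → x ⁻¹ ∙ (u ⁻¹ ∙ v)) xuu≡x ⟩
        x ⁻¹ ∙ (u ⁻¹ ∙ x)            ≡⟨ assoc _ _ _ ⟨
        x ⁻¹ ∙ u ⁻¹ ∙ x              ≡⟨ cong (λ v → x ⁻¹ ∙ v ∙ x) u⁻¹≡u ⟩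
        x ⁻¹ ∙ u ∙ x                 ∎
        where
        xuu≡x : x ∙ u ∙ u ≡ x
        xuu≡x = trans (assoc x u u) (trans (cong (x ∙_) uu) (identityʳ x))

    Normalises⇔Hℓ : ∀ x → Normalises x ⇔ (∃[ h ] ∃[ a ] (H h × a on ℓ × x ≡ h ∙ a))
    Normalises⇔Hℓ x = mk⇔ to from
      where
      from : ∃[ h ] ∃[ a ] (H h × a on ℓ × x ≡ h ∙ a) → Normalises x
      from (h , a , hh , aℓ , refl) = normalises-∙ (H-normalises hh) (on-ℓ-normalises aℓ)

      to : Normalises x → ∃[ h ] ∃[ a ] (H h × a on ℓ × x ≡ h ∙ a)
      to ℓx≡ℓ with fixedLine⇒fixedPoint g g-fixes-ε (g-stabilises-translate ℓx≡ℓ)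
      ... | p , pxℓ , gp≡p with on-image⁻¹ (leftMul x) pxℓ
      ... | a , aℓ , p≡ = p , a ⁻¹ , g-fixed⇒H gp≡p , ⁻¹-on-ℓ aℓ ,
                          x≈z//y x a p (sym (trans p≡ (pt-leftMul x a)))

lemma4p3 : (T : FinGroup) (S : GQ (FinGroup.Carrier T)) (G : FinGroup)
    (A : AutGroup S G) (hs : HSType T S G A) →
    let open FinGroup T
        open GQ S
        open AutGroup A
        open HSType hs
    in (ℓ : Line) → (ε I ℓ) ≡ true →
       (u : Carrier) → u ≢ ε → u ∙ u ≡ ε → (u I ℓ) ≡ true →
       let g = ι (u , u)
           H = λ (x : Carrier) → x ∙ u ≡ u ∙ x
           Nℓ = λ (x : Carrier) →
                  ∀ z → (∃[ a ] ((a I ℓ) ≡ true × z ≡ (x ⁻¹) ∙ a ∙ x))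
                          ⇔ ((z I ℓ) ≡ true)
           P₁ = λ (x : Carrier) → (pt g x ≢ x) × Collinear x (pt g x)
       in ((ℓ′ : Line) → ln g ℓ′ ≡ ℓ′ →
             ∃[ y ] ∃[ m ] (H y × (ε I m) ≡ true × ℓ′ ≡ ln (ι (y , ε)) m))
          × (∀ x → P₁ x ⇔ (Nℓ x × ¬ H x))
          × (∀ x → Nℓ x ⇔ (∃[ h ] ∃[ a ] (H h × (a I ℓ) ≡ true × x ≡ h ∙ a)))
lemma4p3 T S G A hs ℓ εℓ u u≢ε uu uℓ =
  g-fixedLine⇒rightMul ,
  (λ x → (⇔-sym (Nℓ⇔Normalises x) ×-⇔ ⇔-id _) ⇔-∘ P₁⇔Normalises∖H x) ,
  (λ x → Normalises⇔Hℓ x ⇔-∘ Nℓ⇔Normalises x)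
  where
  open HSAction T S G A hs
  open Involution ℓ εℓ u u≢ε uu uℓ
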